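{- Let $K=(U,\{Q_w\}_{w\in U},S[\,],q[\,])$ be a $\textsc{KnapsackExtendWeak}^+$ instance and let $V,V'\subseteq U$ with $V\cap V'=\emptyset$. If $Y_V$ is a solution that correctly solves $K|_V$, and $Y_{V'}$ is a solution that correctly solves $K^{(V\gets Y_V)}|_{V'}$, then $Y_{V'}\circ Y_V$ correctly solves $K|_{V\cup V'}$.
   Context: A function $f\colon\mathbb{Z}_{\ge0}\to\mathbb{Z}$ is strictly concave if $f(x)-f(x-1)>f(x+1)-f(x)$ for all $x\ge1$. An instance $K=(U,\{Q_w\}_{w\in U},S[0..L-1],q[0..L-1])$ of $\textsc{KnapsackExtendWeak}^+$ consists of $U\subseteq\{1,\dots,w_{\max}\}$; strictly concave $Q_w\colon\mathbb{Z}_{\ge0}\to\mathbb{Z}$ with $Q_w(0)=0$; values $q[i]\in\mathbb{Z}$ for $0\le i\le L-1$ (with $q[i]=-\infty$ outside this range); and sets $S[i]\subseteq U$. A solution is $Y=(\vec x[\,],z[\,],r[\,])$ where for each $0\le i\le L-1$, $\vec x[i]\in\mathbb{Z}_{\ge0}^U$, $z[i]=i-\sum_{w\in U}w\cdot x[i]_w$, and $r[i]=q[z[i]]+\sum_{w\in U}Q_w(x[i]_w)$. $Y$ correctly solves $K$ if for every $i$: whenever all maximizers $(z,\vec x)$ of $q[z]+\sum_{w\in U}Q_w(x_w)$ over $\vec x\in\mathbb{Z}_{\ge0}^U$ with $z=i-\sum_w w x_w$ satisfy $\mathrm{supp}(\vec x)\subseteq S[z]$, the pair $(z[i],\vec x[i])$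 is such a maximizer (otherwise no requirement is imposed for $i$). Here $\mathrm{supp}(\vec x)=\{w:x_w\ne0\}$. Restriction: for $V\subseteq U$, $K|_V=(V,\{Q_w\}_{w\in V},S_V[\,],q[\,])$ with $S_V[i]=S[i]\cap V$. Updating: if $Y_V=(\vec x[\,],z[\,],r[\,])$ is a solution to $K|_V$, then $K^{(V\gets Y_V)}=(U\setminus V,\{Q_w\}_{w\in U\setminus V},S'[\,],q'[\,])$ with $S'[i]=S[z[i]]\setminus V$ and $q'[i]=r[i]$. Composition: for disjoint $V,V'\subseteq U$, if $Y_V=(\vec x[\,],z[\,],r[\,])$ is a solution to $K|_V$ and $Y_{V'}=(\vec x'[\,],z'[\,],r'[\,])$ is a solution to $K^{(V\gets Y_V)}|_{V'}$, then $Y_{V'}\circ Y_V=(\vec x''[\,],z''[\,],r'[\,])$ with $z''[i]=z[z'[i]]$ and $\vec x''[i]=\vec x'[i]+\vec x[z'[i]]$ (vectors indexed by $V\cup V'$). -}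

module Defs where

open import Data.Nat using (ℕ; zero; suc; _<?_)
open import Data.Integer using (ℤ; +_; -[1+_]; 0ℤ; _-_; _<_) renaming (_+_ to _+ℤ_; _*_ to _*ℤ_; _≤_ to _≤ℤ_)
open import Data.Fin using (Fin; toℕ; fromℕ<)
open import Data.Fin.Subset using (Subset; _∈_; _∉_; _∩_; _─_; ⊥)
open import Data.Vec using (lookup)
open import Data.Bool using (if_then_else_)
open import Data.Product using (_×_)
open import Relation.Nullary using (¬_; yes; no)
open import Relation.Binary.PropositionalEquality using (_≡_)

data ℤ∞ : Set where
  -∞  : ℤ∞
  fin : ℤ → ℤ∞

infixl 6 _+∞_
_+∞_ : ℤ∞ → ℤ → ℤ∞
-∞    +∞ b = -∞
fin a +∞ b = fin (a +ℤ b)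

infix 4 _≤∞_
data _≤∞_ : ℤ∞ → ℤ∞ → Set where
  -∞≤   : ∀ {a} → -∞ ≤∞ a
  fin≤  : ∀ {a b} → a ≤ℤ b → fin a ≤∞ fin b

∑ : ∀ {n} → (Fin n → ℤ) → ℤ
∑ {zero}  f = 0ℤ
∑ {suc n} f = f Fin.zero +ℤ ∑ (λ i → f (Fin.suc i))

-- Weights: the element w : Fin wmax stands for the weight toℕ w + 1,
-- so subsets of Fin wmax are subsets of {1, …, wmax}.

weight : ∀ {wmax} → Fin wmax → ℤ
weight w = + suc (toℕ w)

StrictlyConcave : (ℕ → ℤ) → Set
StrictlyConcave f = ∀ n → f (suc (suc n)) - f (suc n) < f (suc n) - f n

-- Instances. q and S are given at the indices 0 … L-1 (as Fin L);
-- q is allowed to take the value -∞ so that updated instances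
-- (whose q' is the r[] of a solution) have the same type.

record Instance (wmax L : ℕ) : Set where
  field
    U : Subset wmax
    Q : Fin wmax → ℕ → ℤ
    S : Fin L → Subset wmax
    q : Fin L → ℤ∞
open Instance public

IsKnapsackInstance : ∀ {wmax L} → Instance wmax L → Set
IsKnapsackInstance {wmax} {L} K =
  (∀ (w : Fin wmax) → w ∈ U K → (Q K w 0 ≡ 0ℤ) × StrictlyConcave (Q K w))
  × (∀ (i : Fin L) → ¬ (q K i ≡ -∞))

qAt : ∀ {wmax L} → Instance wmax L → ℤ → ℤ∞
qAt {L = L} K (+ n) with n <? L
... | yes p = q K (fromℕ< p)
... | no _  = -∞
qAt K -[1+ _ ] = -∞

SAt : ∀ {wmax L} → Instance wmax L → ℤ → Subset wmax
SAt {L = L} K (+ n) with n <? L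
... | yes p = S K (fromℕ< p)
... | no _  = ⊥
SAt K -[1+ _ ] = ⊥

-- Vectors in ℤ≥0^U are represented as Fin wmax → ℕ vanishing outside U.

Vect : ℕ → Set
Vect wmax = Fin wmax → ℕ

SupportedIn : ∀ {wmax} → Subset wmax → Vect wmax → Set
SupportedIn U x = ∀ w → w ∉ U → x w ≡ 0

SuppIn : ∀ {wmax} → Vect wmax → Subset wmax → Set
SuppIn x T = ∀ w → ¬ (x w ≡ 0) → w ∈ T

zOf : ∀ {wmax} → ℤ → Vect wmax → ℤ
zOf i x = i - ∑ (λ w → weight w *ℤ + x w)

QSum : ∀ {wmax L} → Instance wmax L → Vect wmax → ℤ
QSum K x = ∑ (λ w → if lookup (U K) w then Q K w (x w) else 0ℤ)

val : ∀ {wmax L} → Instance wmax L → ℤ → Vect wmax → ℤ∞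
val K i x = qAt K (zOf i x) +∞ QSum K x

IsMaximizer : ∀ {wmax L} → Instance wmax L → Fin L → Vect wmax → Set
IsMaximizer {wmax} K i x =
  SupportedIn (U K) x ×
  (∀ (y : Vect wmax) → SupportedIn (U K) y → val K (+ toℕ i) y ≤∞ val K (+ toℕ i) x)

-- Solutions. A solution Y = (x[], z[], r[]) is determined by x[]:
-- z[i] and r[i] are given by the defining equations.

Sol : ℕ → ℕ → Set
Sol wmax L = Fin L → Vect wmax

IsSolution : ∀ {wmax L} → Instance wmax L → Sol wmax L → Set
IsSolution K Y = ∀ i → SupportedIn (U K) (Y i)

zSol : ∀ {wmax L} → Sol wmax L → Fin L → ℤ
zSol Y i = zOf (+ toℕ i) (Y i)

rSol : ∀ {wmax L} → Instance wmax L → Sol wmax L → Fin L → ℤ∞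
rSol K Y i = val K (+ toℕ i) (Y i)

xAt : ∀ {wmax L} → Sol wmax L → ℤ → Vect wmax
xAt {L = L} Y (+ n) with n <? L
... | yes p = Y (fromℕ< p)
... | no _  = λ _ → 0
xAt Y -[1+ _ ] = λ _ → 0

CorrectlySolves : ∀ {wmax L} → Instance wmax L → Sol wmax L → Set
CorrectlySolves {wmax} {L} K Y =
  IsSolution K Y ×
  (∀ (i : Fin L) →
     (∀ (x : Vect wmax) → IsMaximizer K i x → SuppIn x (SAt K (zOf (+ toℕ i) x))) →
     IsMaximizer K i (Y i))

_∣_ : ∀ {wmax L} → Instance wmax L → Subset wmax → Instance wmax L
K ∣ V = record { U = V ; Q = Q K ; S = λ i → S K i ∩ V ; q = q K }

update : ∀ {wmax L} → Instance wmax L → Subset wmax → Sol wmax L → Instance wmax L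
update K V YV = record
  { U = U K ─ V
  ; Q = Q K
  ; S = λ i → SAt K (zSol YV i) ─ V
  ; q = λ i → rSol (K ∣ V) YV i
  }

_∘Y_ : ∀ {wmax L} → Sol wmax L → Sol wmax L → Sol wmax L
(YV' ∘Y YV) i w = YV' i w Data.Nat.+ xAt YV (zSol YV' i) w

-- Split a maximizer x* for index i of K|(V ∪ V') into its V'-part x' and its V-part.  Its
-- value is the value of the V-part in K|V at the residual index k = i − Σ w·x'_w, plus
-- Σ_{w∈V'} Q_w(x'_w).  Hence x' completed by any maximizer of K|V at k is again a maximizer
-- for i, so the support hypothesis at i passes to K|V at k; Y_V(k) is then optimal there,
-- and every x' with value at least that of x* in K^(V←Y_V)|V' completes, via Y_V at its own
-- residual index, to a maximizer for i.  This passes the hypothesis on to K^(V←Y_V)|V', and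
-- Y_V'(i) completed by Y_V is the sought maximizer.  Maximizers exist because a vector of
-- finite value has a nonnegative residual index, which confines it to a finite box.

module Submission where

open import Defs
open import Data.Bool.Base using (true; false; _∨_; if_then_else_)
open import Data.Empty using (⊥-elim)
open import Data.Fin.Base using (Fin; zero; suc; toℕ; fromℕ<)
import Data.Fin.Properties as Fin
open import Data.Fin.Subset using (Subset; _∈_; _∉_; _∩_; _∪_; _─_; _⊆_; Empty)
open import Data.Fin.Subset.Properties using (_∈?_; x∈p∩q⁺; x∈p∩q⁻; x∈p∪q⁺; x∈p∪q⁻; ∩-zeroˡ)
open import Data.Integer.Base as ℤ using (ℤ; +_; -[1+_]; 0ℤ; _-_; -_; +≤+)
  renaming (_+_ to _+ℤ_; _*_ to _*ℤ_; _≤_ to _≤ℤ_)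
import Data.Integer.Properties as ℤ
open import Algebra.Properties.CommutativeMonoid.Sum ℤ.+-0-commutativeMonoid
  using (sum; sum-cong-≗; ∑-distrib-+)
open import Data.Nat.Base as ℕ using (ℕ; zero; suc; z≤n; _≤_)
import Data.Nat.Properties as ℕ
open import Data.Nat.Properties using (_<?_)
open import Data.Product using (Σ; ∃-syntax; _×_; _,_; proj₁; proj₂)
open import Data.Sum using (_⊎_; inj₁; inj₂; [_,_])
open import Data.Vec.Base using (lookup; _∷_; here; there)
import Data.Vec.Functional as Vector
open import Data.Vec.Functional.Relation.Binary.Pointwise using (Pointwise)
import Data.Vec.Properties as Vec
open import Function using (_∘_)
open import Relation.Nullary using (¬_; yes; no; contradiction)
open import Relation.Binary.PropositionalEquality
  using (_≡_; _≗_; refl; sym; trans; cong; cong₂; subst; subst₂; module ≡-Reasoning)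

≤∞-refl : ∀ {a} → a ≤∞ a
≤∞-refl { -∞}    = -∞≤
≤∞-refl {fin a} = fin≤ ℤ.≤-refl

≤∞-reflexive : ∀ {a b} → a ≡ b → a ≤∞ b
≤∞-reflexive refl = ≤∞-refl

≤∞-trans : ∀ {a b c} → a ≤∞ b → b ≤∞ c → a ≤∞ c
≤∞-trans -∞≤      _        = -∞≤
≤∞-trans (fin≤ p) (fin≤ q) = fin≤ (ℤ.≤-trans p q)

≤∞-total : ∀ a b → a ≤∞ b ⊎ b ≤∞ a
≤∞-total -∞      _       = inj₁ -∞≤
≤∞-total (fin a) -∞      = inj₂ -∞≤
≤∞-total (fin a) (fin b) with ℤ.≤-total a b
... | inj₁ a≤b = inj₁ (fin≤ a≤b)
... | inj₂ b≤a = inj₂ (fin≤ b≤a)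

+∞-monoˡ-≤∞ : ∀ {a b} c → a ≤∞ b → a +∞ c ≤∞ b +∞ c
+∞-monoˡ-≤∞ c -∞≤      = -∞≤
+∞-monoˡ-≤∞ c (fin≤ p) = fin≤ (ℤ.+-monoˡ-≤ c p)

+∞-assoc : ∀ a b c → (a +∞ b) +∞ c ≡ a +∞ (b +ℤ c)
+∞-assoc -∞      b c = refl
+∞-assoc (fin a) b c = cong fin (ℤ.+-assoc a b c)

data Finite : ℤ∞ → Set where
  finite : ∀ a → Finite (fin a)

Finite-≤∞ : ∀ {a b} → Finite a → a ≤∞ b → Finite b
Finite-≤∞ (finite _) (fin≤ _) = finite _

Finite-+∞ : ∀ a {c} → Finite (a +∞ c) → Finite a
Finite-+∞ -∞      ()
Finite-+∞ (fin a) _  = finite a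

≤∞-from-finite : ∀ {a b} → (Finite a → a ≤∞ b) → a ≤∞ b
≤∞-from-finite { -∞}    _ = -∞≤
≤∞-from-finite {fin a} h = h (finite a)

∑≡sum : ∀ {n} (f : Fin n → ℤ) → ∑ f ≡ sum f
∑≡sum {zero}  f = refl
∑≡sum {suc n} f = cong (f zero +ℤ_) (∑≡sum (f ∘ suc))

∑-cong : ∀ {n} {f g : Fin n → ℤ} → f ≗ g → ∑ f ≡ ∑ g
∑-cong {f = f} {g} f≗g = begin
  ∑ f   ≡⟨ ∑≡sum f ⟩
  sum f ≡⟨ sum-cong-≗ f≗g ⟩
  sum g ≡⟨ ∑≡sum g ⟨
  ∑ g   ∎
  where open ≡-Reasoning

∑-distrib : ∀ {n} (f g : Fin n → ℤ) → ∑ (λ w → f w +ℤ g w) ≡ ∑ f +ℤ ∑ g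
∑-distrib f g = begin
  ∑ (λ w → f w +ℤ g w)   ≡⟨ ∑≡sum (λ w → f w +ℤ g w) ⟩
  sum (λ w → f w +ℤ g w) ≡⟨ ∑-distrib-+ f g ⟩
  sum f +ℤ sum g         ≡⟨ cong₂ _+ℤ_ (∑≡sum f) (∑≡sum g) ⟨
  ∑ f +ℤ ∑ g             ∎
  where open ≡-Reasoning

∑-nonneg : ∀ {n} {f : Fin n → ℤ} → (∀ w → 0ℤ ≤ℤ f w) → 0ℤ ≤ℤ ∑ f
∑-nonneg {zero}  _   = ℤ.≤-refl
∑-nonneg {suc n} f≥0 = ℤ.+-mono-≤ (f≥0 zero) (∑-nonneg (f≥0 ∘ suc))

term≤∑ : ∀ {n} {f : Fin n → ℤ} → (∀ w → 0ℤ ≤ℤ f w) → ∀ w → f w ≤ℤ ∑ f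
term≤∑ {f = f} f≥0 zero    = ℤ.i≤i+j (f zero) _ {{ℤ.nonNegative (∑-nonneg (f≥0 ∘ suc))}}
term≤∑ {f = f} f≥0 (suc w) =
  ℤ.i≤j⇒i≤k+j (f zero) {{ℤ.nonNegative (f≥0 zero)}} (term≤∑ (f≥0 ∘ suc) w)

_⊕_ : ∀ {n} → Vect n → Vect n → Vect n
(x ⊕ y) w = x w ℕ.+ y w

weightedSum : ∀ {n} → Vect n → ℤ
weightedSum x = ∑ (λ w → weight w *ℤ + x w)

weighted-term-nonneg : ∀ {n} (w : Fin n) m → 0ℤ ≤ℤ weight w *ℤ + m
weighted-term-nonneg w m = subst (0ℤ ≤ℤ_) (ℤ.pos-* (suc (toℕ w)) m) (+≤+ z≤n)

≤-weighted-term : ∀ {n} (w : Fin n) m → + m ≤ℤ weight w *ℤ + m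
≤-weighted-term w m = subst (+ m ≤ℤ_) (ℤ.pos-* (suc (toℕ w)) m) (+≤+ (ℕ.m≤m+n m _))

weightedSum-nonneg : ∀ {n} (x : Vect n) → 0ℤ ≤ℤ weightedSum x
weightedSum-nonneg x = ∑-nonneg (λ w → weighted-term-nonneg w (x w))

≤-weightedSum : ∀ {n} (x : Vect n) w → + x w ≤ℤ weightedSum x
≤-weightedSum x w =
  ℤ.≤-trans (≤-weighted-term w (x w)) (term≤∑ (λ w → weighted-term-nonneg w (x w)) w)

weightedSum-⊕ : ∀ {n} (x y : Vect n) → weightedSum (x ⊕ y) ≡ weightedSum x +ℤ weightedSum y
weightedSum-⊕ x y =
  trans (∑-cong distrib) (∑-distrib (λ w → weight w *ℤ + x w) (λ w → weight w *ℤ + y w))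
  where
  distrib : ∀ w → weight w *ℤ + (x w ℕ.+ y w) ≡ weight w *ℤ + x w +ℤ weight w *ℤ + y w
  distrib w = trans (cong (weight w *ℤ_) (ℤ.pos-+ (x w) (y w)))
                    (ℤ.*-distribˡ-+ (weight w) (+ x w) (+ y w))

zOf-⊕ : ∀ {n} z (x y : Vect n) → zOf z (x ⊕ y) ≡ zOf (zOf z x) y
zOf-⊕ z x y = begin
  z - weightedSum (x ⊕ y)                    ≡⟨ cong (λ s → z - s) (weightedSum-⊕ x y) ⟩
  z - (weightedSum x +ℤ weightedSum y)       ≡⟨ cong (z +ℤ_) (ℤ.neg-distrib-+ (weightedSum x) _) ⟩
  z +ℤ (- weightedSum x +ℤ - weightedSum y)  ≡⟨ ℤ.+-assoc z _ _ ⟨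
  z - weightedSum x - weightedSum y          ∎
  where open ≡-Reasoning

zOf-≤ : ∀ {n} z (x : Vect n) → zOf z x ≤ℤ z
zOf-≤ z x = ℤ.i-j≤i z (weightedSum x) {{ℤ.nonNegative (weightedSum-nonneg x)}}

zOf-nonneg⇒≤ : ∀ {n} m (x : Vect n) → 0ℤ ≤ℤ zOf (+ m) x → ∀ w → x w ≤ m
zOf-nonneg⇒≤ m x z≥0 w =
  ℤ.drop‿+≤+ (ℤ.≤-trans (≤-weightedSum x w) (ℤ.0≤i-j⇒j≤i z≥0))

InRange : ℕ → ℤ → Set
InRange L z = Σ (Fin L) λ k → z ≡ + toℕ k

InRange-nonneg : ∀ {L z} → InRange L z → 0ℤ ≤ℤ z
InRange-nonneg (k , refl) = +≤+ z≤n

InRange-≤ : ∀ {L z} (i : Fin L) → 0ℤ ≤ℤ z → z ≤ℤ + toℕ i → InRange L z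
InRange-≤ i (+≤+ {n = n} _) (+≤+ n≤i) = fromℕ< n<L , cong +_ (sym (Fin.toℕ-fromℕ< n<L))
  where
  n<L : n ℕ.< _
  n<L = ℕ.≤-<-trans n≤i (Fin.toℕ<n i)

zOf-prefix-InRange : ∀ {L n} (i : Fin L) (x y : Vect n) →
                     0ℤ ≤ℤ zOf (+ toℕ i) (x ⊕ y) → InRange L (zOf (+ toℕ i) x)
zOf-prefix-InRange i x y z≥0 = InRange-≤ i
  (ℤ.≤-trans z≥0 (subst (_≤ℤ zOf I x) (sym (zOf-⊕ I x y)) (zOf-≤ (zOf I x) y)))
  (zOf-≤ I x)
  where
  I : ℤ
  I = + toℕ i

lookup⇒∈ : ∀ {n} {p : Subset n} {w} → lookup p w ≡ true → w ∈ p
lookup⇒∈ {p = p} {w} = Vec.lookup⇒[]= w p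

∉⇒lookup≡false : ∀ {n} {p : Subset n} {w} → w ∉ p → lookup p w ≡ false
∉⇒lookup≡false {p = p} {w} w∉p with lookup p w in e
... | true  = contradiction (lookup⇒∈ e) w∉p
... | false = refl

lookup≡false⇒∉ : ∀ {n} {p : Subset n} {w} → lookup p w ≡ false → w ∉ p
lookup≡false⇒∉ e w∈p with trans (sym (Vec.[]=⇒lookup w∈p)) e
... | ()

lookup-∪ : ∀ {n} (p q : Subset n) w → lookup (p ∪ q) w ≡ lookup p w ∨ lookup q w
lookup-∪ p q w = Vec.lookup-zipWith _∨_ w p q

x∈p─q⁺ : ∀ {n} {p q : Subset n} {w} → w ∈ p → w ∉ q → w ∈ p ─ q
x∈p─q⁺ {q = true  ∷ _} here        w∉q = contradiction here w∉q
x∈p─q⁺ {q = false ∷ _} here        _   = here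
x∈p─q⁺ {q = _     ∷ _} (there w∈p) w∉q = there (x∈p─q⁺ w∈p (w∉q ∘ there))

supportedIn⇒suppIn : ∀ {n} {T : Subset n} {x} → SupportedIn T x → SuppIn x T
supportedIn⇒suppIn {T = T} x-supp w xw≢0 with w ∈? T
... | yes w∈T = w∈T
... | no  w∉T = contradiction (x-supp w w∉T) xw≢0

⊕-supportedIn : ∀ {n} {S T : Subset n} {x y} →
                SupportedIn S x → SupportedIn T y → SupportedIn (T ∪ S) (x ⊕ y)
⊕-supportedIn x-supp y-supp w w∉T∪S =
  cong₂ ℕ._+_ (x-supp w (w∉T∪S ∘ x∈p∪q⁺ ∘ inj₂)) (y-supp w (w∉T∪S ∘ x∈p∪q⁺ ∘ inj₁))

restrict : ∀ {n} → Subset n → Vect n → Vect n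
restrict T x w = if lookup T w then x w else 0

restrict-supportedIn : ∀ {n} {T : Subset n} {x} → SupportedIn T (restrict T x)
restrict-supportedIn w w∉T rewrite ∉⇒lookup≡false w∉T = refl

restrict-split : ∀ {n} {S T : Subset n} {x} → Empty (S ∩ T) → SupportedIn (S ∪ T) x →
                 x ≗ restrict T x ⊕ restrict S x
restrict-split {S = S} {T} {x} S∩T≡∅ x-supp w with lookup T w in eT | lookup S w in eS
... | true  | true  = ⊥-elim (S∩T≡∅ (w , x∈p∩q⁺ (lookup⇒∈ eS , lookup⇒∈ eT)))
... | true  | false = sym (ℕ.+-identityʳ (x w))
... | false | true  = refl
... | false | false = x-supp w ([ lookup≡false⇒∉ eS , lookup≡false⇒∉ eT ] ∘ x∈p∪q⁻ S T)

masked : ∀ {n} → Subset n → (Fin n → ℕ → ℤ) → Vect n → Fin n → ℤ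
masked T g x w = if lookup T w then g w (x w) else 0ℤ

∑-masked-⊕ : ∀ {n} {S T : Subset n} {x y} (g : Fin n → ℕ → ℤ) → Empty (S ∩ T) →
             SupportedIn T x → SupportedIn S y →
             ∑ (masked (S ∪ T) g (x ⊕ y)) ≡ ∑ (masked T g x) +ℤ ∑ (masked S g y)
∑-masked-⊕ {S = S} {T} {x} {y} g S∩T≡∅ x-supp y-supp =
  trans (∑-cong split) (∑-distrib (masked T g x) (masked S g y))
  where
  split : ∀ w → (if lookup (S ∪ T) w then g w (x w ℕ.+ y w) else 0ℤ)
              ≡ (if lookup T w then g w (x w) else 0ℤ) +ℤ (if lookup S w then g w (y w) else 0ℤ)
  split w rewrite lookup-∪ S T w with lookup S w in eS | lookup T w in eT
  ... | true  | true  = ⊥-elim (S∩T≡∅ (w , x∈p∩q⁺ (lookup⇒∈ eS , lookup⇒∈ eT)))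
  ... | true  | false rewrite x-supp w (lookup≡false⇒∉ eT) = sym (ℤ.+-identityˡ _)
  ... | false | true  rewrite y-supp w (lookup≡false⇒∉ eS) | ℕ.+-identityʳ (x w) =
    sym (ℤ.+-identityʳ _)
  ... | false | false = refl

module _ {wmax L : ℕ} where

  xAt-toℕ : ∀ (Y : Sol wmax L) k → xAt Y (+ toℕ k) ≡ Y k
  xAt-toℕ Y k with toℕ k <? L
  ... | yes k<L = cong Y (Fin.fromℕ<-toℕ k k<L)
  ... | no  k≮L = contradiction (Fin.toℕ<n k) k≮L

  xAt-supportedIn : ∀ {T} {Y : Sol wmax L} → (∀ k → SupportedIn T (Y k)) →
                    ∀ z → SupportedIn T (xAt Y z)
  xAt-supportedIn Y-supp (+ n) with n <? L
  ... | yes _ = Y-supp _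
  ... | no  _ = λ _ _ → refl
  xAt-supportedIn Y-supp -[1+ _ ] = λ _ _ → refl

  module _ (K : Instance wmax L) where

    qAt-toℕ : ∀ k → qAt K (+ toℕ k) ≡ q K k
    qAt-toℕ k with toℕ k <? L
    ... | yes k<L = cong (q K) (Fin.fromℕ<-toℕ k k<L)
    ... | no  k≮L = contradiction (Fin.toℕ<n k) k≮L

    SAt-toℕ : ∀ k → SAt K (+ toℕ k) ≡ S K k
    SAt-toℕ k with toℕ k <? L
    ... | yes k<L = cong (S K) (Fin.fromℕ<-toℕ k k<L)
    ... | no  k≮L = contradiction (Fin.toℕ<n k) k≮L

    qAt-∣ : ∀ T z → qAt (K ∣ T) z ≡ qAt K z
    qAt-∣ T (+ n) with n <? L
    ... | yes _ = refl
    ... | no  _ = refl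
    qAt-∣ T -[1+ _ ] = refl

    SAt-∣ : ∀ T z → SAt (K ∣ T) z ≡ SAt K z ∩ T
    SAt-∣ T (+ n) with n <? L
    ... | yes _ = refl
    ... | no  _ = sym (∩-zeroˡ T)
    SAt-∣ T -[1+ _ ] = sym (∩-zeroˡ T)

    Finite-qAt⇒InRange : ∀ {z} → Finite (qAt K z) → InRange L z
    Finite-qAt⇒InRange {+ n} q-finite with n <? L
    ... | yes n<L = fromℕ< n<L , cong +_ (sym (Fin.toℕ-fromℕ< n<L))
    Finite-qAt⇒InRange {+ n} () | no _
    Finite-qAt⇒InRange { -[1+ _ ]} ()

    Finite-val⇒InRange : ∀ z x → Finite (val K z x) → InRange L (zOf z x)
    Finite-val⇒InRange z x = Finite-qAt⇒InRange ∘ Finite-+∞ (qAt K (zOf z x))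

    val-cong : ∀ z {x y} → x ≗ y → val K z x ≡ val K z y
    val-cong z x≗y = cong₂ _+∞_
      (cong (λ s → qAt K (z - s)) (∑-cong λ w → cong (λ m → weight w *ℤ + m) (x≗y w)))
      (∑-cong λ w → cong (λ m → if lookup (U K) w then Q K w m else 0ℤ) (x≗y w))

≤-suc-cases : ∀ {m n} → m ≤ suc n → m ≤ n ⊎ m ≡ suc n
≤-suc-cases m≤1+n with ℕ.m≤n⇒m<n∨m≡n m≤1+n
... | inj₁ m<1+n = inj₁ (ℕ.s≤s⁻¹ m<1+n)
... | inj₂ m≡1+n = inj₂ m≡1+n

argmax-≤ : ∀ (h : ℕ → ℤ∞) B → ∃[ c ] c ≤ B × (∀ {c'} → c' ≤ B → h c' ≤∞ h c)
argmax-≤ h zero = 0 , z≤n , λ { z≤n → ≤∞-refl }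
argmax-≤ h (suc B) with argmax-≤ h B
... | c , c≤B , c-max with ≤∞-total (h (suc B)) (h c)
...   | inj₁ last≤c = c , ℕ.m≤n⇒m≤1+n c≤B , c-max′
  where
  c-max′ : ∀ {c'} → c' ≤ suc B → h c' ≤∞ h c
  c-max′ c'≤1+B with ≤-suc-cases c'≤1+B
  ... | inj₁ c'≤B = c-max c'≤B
  ... | inj₂ refl = last≤c
...   | inj₂ c≤last = suc B , ℕ.≤-refl , last-max
  where
  last-max : ∀ {c'} → c' ≤ suc B → h c' ≤∞ h (suc B)
  last-max c'≤1+B with ≤-suc-cases c'≤1+B
  ... | inj₁ c'≤B = ≤∞-trans (c-max c'≤B) c≤last
  ... | inj₂ refl = ≤∞-refl

ArgmaxIn : ∀ {n} → Vect n → (Vect n → ℤ∞) → Set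
ArgmaxIn B f = ∃[ x ] Pointwise _≤_ x B × (∀ y → Pointwise _≤_ y B → f y ≤∞ f x)

argmax-box : ∀ {n} (B : Vect n) (f : Vect n → ℤ∞) →
             (∀ {x y} → x ≗ y → f x ≡ f y) → ArgmaxIn B f
argmax-box {zero}  B f f-cong = (λ ()) , (λ ()) , λ _ _ → ≤∞-reflexive (f-cong (λ ()))
argmax-box {suc n} B f f-cong = extend (argmax-≤ h (B zero))
  where
  best-tail : ∀ c → ArgmaxIn (Vector.tail B) (λ r → f (c Vector.∷ r))
  best-tail c = argmax-box (Vector.tail B) (λ r → f (c Vector.∷ r))
    (λ r≗r' → f-cong λ { zero → refl ; (suc w) → r≗r' w })

  h : ℕ → ℤ∞
  h c = f (c Vector.∷ proj₁ (best-tail c))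

  extend : ∃[ c ] c ≤ B zero × (∀ {c'} → c' ≤ B zero → h c' ≤∞ h c) → ArgmaxIn B f
  extend (c , c≤B₀ , c-max) = c Vector.∷ r , x≤B , x-max
    where
    r : Vect n
    r = proj₁ (best-tail c)

    x≤B : Pointwise _≤_ (c Vector.∷ r) B
    x≤B zero    = c≤B₀
    x≤B (suc w) = proj₁ (proj₂ (best-tail c)) w

    x-max : ∀ y → Pointwise _≤_ y B → f y ≤∞ f (c Vector.∷ r)
    x-max y y≤B = subst (_≤∞ f (c Vector.∷ r)) (f-cong λ { zero → refl ; (suc w) → refl })
      (≤∞-trans (proj₂ (proj₂ (best-tail (y zero))) (Vector.tail y) (y≤B ∘ suc))
                (c-max (y≤B zero)))

module _ {wmax L : ℕ} (K : Instance wmax L) (i : Fin L) where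

  maximizer-≤ : ∀ {x y} → IsMaximizer K i x → SupportedIn (U K) y →
                val K (+ toℕ i) x ≤∞ val K (+ toℕ i) y → IsMaximizer K i y
  maximizer-≤ (_ , x-max) y-supp x≤y = y-supp , λ z z-supp → ≤∞-trans (x-max z z-supp) x≤y

  box : Vect wmax
  box w = if lookup (U K) w then toℕ i else 0

  in-box⇒supportedIn : ∀ {x} → Pointwise _≤_ x box → SupportedIn (U K) x
  in-box⇒supportedIn {x} x≤box w w∉U with lookup (U K) w | ∉⇒lookup≡false w∉U | x≤box w
  ... | .false | refl | x≤0 = ℕ.n≤0⇒n≡0 x≤0

  finite⇒in-box : ∀ y → SupportedIn (U K) y → Finite (val K (+ toℕ i) y) → Pointwise _≤_ y box
  finite⇒in-box y y-supp y-finite w with lookup (U K) w in e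
  ... | true  =
    zOf-nonneg⇒≤ (toℕ i) y (InRange-nonneg (Finite-val⇒InRange K (+ toℕ i) y y-finite)) w
  ... | false = ℕ.≤-reflexive (y-supp w (lookup≡false⇒∉ e))

  maximizer-exists : ∃[ x ] IsMaximizer K i x
  maximizer-exists with argmax-box box (val K (+ toℕ i)) (val-cong K (+ toℕ i))
  ... | x , x≤box , x-max =
    x , in-box⇒supportedIn x≤box , λ y y-supp → ≤∞-from-finite (x-max y ∘ finite⇒in-box y y-supp)

module Composition {wmax L : ℕ} (K : Instance wmax L) (V V' : Subset wmax)
                   (V∩V'≡∅ : Empty (V ∩ V')) (YV YV' : Sol wmax L) where

  K₀ K₁ K₂ : Instance wmax L
  K₀ = K ∣ (V ∪ V')
  K₁ = K ∣ V
  K₂ = update K V YV ∣ V'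

  val-split : ∀ z {x' y} → SupportedIn V' x' → SupportedIn V y →
              val K₀ z (x' ⊕ y) ≡ val K₁ (zOf z x') y +∞ QSum K₂ x'
  val-split z {x'} {y} x'-supp y-supp = begin
    qAt K₀ (zOf z (x' ⊕ y)) +∞ QSum K₀ (x' ⊕ y)
      ≡⟨ cong₂ _+∞_ (trans (qAt-∣ K (V ∪ V') (zOf z (x' ⊕ y))) (cong (qAt K) (zOf-⊕ z x' y)))
                    (∑-masked-⊕ (Q K) V∩V'≡∅ x'-supp y-supp) ⟩
    qAt K z′ +∞ (QSum K₂ x' +ℤ QSum K₁ y)
      ≡⟨ cong (qAt K z′ +∞_) (ℤ.+-comm (QSum K₂ x') (QSum K₁ y)) ⟩
    qAt K z′ +∞ (QSum K₁ y +ℤ QSum K₂ x')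
      ≡⟨ +∞-assoc (qAt K z′) (QSum K₁ y) (QSum K₂ x') ⟨
    (qAt K z′ +∞ QSum K₁ y) +∞ QSum K₂ x'
      ≡⟨ cong (λ a → (a +∞ QSum K₁ y) +∞ QSum K₂ x') (qAt-∣ K V z′) ⟨
    val K₁ (zOf z x') y +∞ QSum K₂ x'
      ∎
    where
    open ≡-Reasoning
    z′ : ℤ
    z′ = zOf (zOf z x') y

  val-⊕-monoʳ : ∀ z {x' u u'} (k : Fin L) → zOf z x' ≡ + toℕ k →
                SupportedIn V' x' → SupportedIn V u → SupportedIn V u' →
                val K₁ (+ toℕ k) u ≤∞ val K₁ (+ toℕ k) u' → val K₀ z (x' ⊕ u) ≤∞ val K₀ z (x' ⊕ u')
  val-⊕-monoʳ z {x'} {u} {u'} k x'≡k x'-supp u-supp u'-supp u≤u' =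
    subst₂ _≤∞_ (sym (val-split z x'-supp u-supp)) (sym (val-split z x'-supp u'-supp))
      (+∞-monoˡ-≤∞ (QSum K₂ x') (subst (λ j → val K₁ j u ≤∞ val K₁ j u') (sym x'≡k) u≤u'))

  -- The updated instance has q'[k] = r[k], the value of YV k in K|V.
  val-update : ∀ z {x'} k → SupportedIn V' x' → SupportedIn V (YV k) → zOf z x' ≡ + toℕ k →
               val K₂ z x' ≡ val K₀ z (x' ⊕ YV k)
  val-update z {x'} k x'-supp YVk-supp x'≡k = begin
    qAt K₂ (zOf z x') +∞ QSum K₂ x'          ≡⟨ cong (λ j → qAt K₂ j +∞ QSum K₂ x') x'≡k ⟩
    qAt K₂ (+ toℕ k) +∞ QSum K₂ x'          ≡⟨ cong (_+∞ QSum K₂ x') (qAt-toℕ K₂ k) ⟩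
    val K₁ (+ toℕ k) (YV k) +∞ QSum K₂ x'   ≡⟨ cong (λ j → val K₁ j (YV k) +∞ QSum K₂ x') x'≡k ⟨
    val K₁ (zOf z x') (YV k) +∞ QSum K₂ x'  ≡⟨ val-split z x'-supp YVk-supp ⟨
    val K₀ z (x' ⊕ YV k)                    ∎
    where open ≡-Reasoning

  module _ (YV-correct : CorrectlySolves K₁ YV) (YV'-correct : CorrectlySolves K₂ YV') where

    YV-supp : IsSolution K₁ YV
    YV-supp = proj₁ YV-correct

    composition-isSolution : IsSolution K₀ (YV' ∘Y YV)
    composition-isSolution i =
      ⊕-supportedIn (proj₁ YV'-correct i) (xAt-supportedIn YV-supp (zSol YV' i))

    module AtIndex (i : Fin L)
                   (premise : ∀ x → IsMaximizer K₀ i x → SuppIn x (SAt K₀ (zOf (+ toℕ i) x))) where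

      I : ℤ
      I = + toℕ i

      x* : Vect wmax
      x* = proj₁ (maximizer-exists K₀ i)

      x*-max : IsMaximizer K₀ i x*
      x*-max = proj₂ (maximizer-exists K₀ i)

      M : ℤ∞
      M = val K₀ I x*

      maximizer⇒∈S : ∀ {x w} → IsMaximizer K₀ i x → ¬ x w ≡ 0 → w ∈ SAt K (zOf I x)
      maximizer⇒∈S {x} {w} x-max xw≢0 =
        proj₁ (x∈p∩q⁻ _ _ (subst (w ∈_) (SAt-∣ K (V ∪ V') (zOf I x)) (premise x x-max w xw≢0)))

      module _ (M-finite : Finite M) where

        xV' xV : Vect wmax
        xV' = restrict V' x*
        xV  = restrict V x*

        M≡xV'⊕xV : M ≡ val K₀ I (xV' ⊕ xV)
        M≡xV'⊕xV = val-cong K₀ I (restrict-split V∩V'≡∅ (proj₁ x*-max))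

        xV'-inRange : InRange L (zOf I xV')
        xV'-inRange = zOf-prefix-InRange i xV' xV
          (subst (0ℤ ≤ℤ_) (sym (zOf-⊕ I xV' xV)) (InRange-nonneg residual-inRange))
          where
          residual-inRange : InRange L (zOf (zOf I xV') xV)
          residual-inRange = Finite-val⇒InRange K₁ (zOf I xV') xV
            (Finite-+∞ (val K₁ (zOf I xV') xV)
              (subst Finite (trans M≡xV'⊕xV (val-split I restrict-supportedIn restrict-supportedIn))
                 M-finite))

        k* : Fin L
        k* = proj₁ xV'-inRange

        xV'≡k* : zOf I xV' ≡ + toℕ k*
        xV'≡k* = proj₂ xV'-inRange

        M≤xV'⊕ : ∀ {u} → SupportedIn V u → val K₁ (+ toℕ k*) xV ≤∞ val K₁ (+ toℕ k*) u →
                 M ≤∞ val K₀ I (xV' ⊕ u)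
        M≤xV'⊕ {u} u-supp xV≤u = subst (_≤∞ val K₀ I (xV' ⊕ u)) (sym M≡xV'⊕xV)
          (val-⊕-monoʳ I k* xV'≡k* restrict-supportedIn restrict-supportedIn u-supp xV≤u)

        YV-premise : ∀ u → IsMaximizer K₁ k* u → SuppIn u (SAt K₁ (zOf (+ toℕ k*) u))
        YV-premise u (u-supp , u-max) w uw≢0 =
          subst (w ∈_) (sym (SAt-∣ K V (zOf (+ toℕ k*) u)))
            (x∈p∩q⁺ (w∈S , supportedIn⇒suppIn u-supp w uw≢0))
          where
          xV'⊕u-max : IsMaximizer K₀ i (xV' ⊕ u)
          xV'⊕u-max = maximizer-≤ K₀ i x*-max (⊕-supportedIn restrict-supportedIn u-supp)
            (M≤xV'⊕ u-supp (u-max xV restrict-supportedIn))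

          w∈S : w ∈ SAt K (zOf (+ toℕ k*) u)
          w∈S = subst (λ z → w ∈ SAt K z) (trans (zOf-⊕ I xV' u) (cong (λ z → zOf z u) xV'≡k*))
                  (maximizer⇒∈S xV'⊕u-max (uw≢0 ∘ ℕ.m+n≡0⇒n≡0 (xV' w)))

        M≤xV' : M ≤∞ val K₂ I xV'
        M≤xV' = subst (M ≤∞_) (sym (val-update I k* restrict-supportedIn (YV-supp k*) xV'≡k*))
          (M≤xV'⊕ (YV-supp k*) (proj₂ (proj₂ YV-correct k* YV-premise) xV restrict-supportedIn))

        extend-by-YV : ∀ {x'} → SupportedIn V' x' → M ≤∞ val K₂ I x' →
                       ∃[ k ] zOf I x' ≡ + toℕ k × IsMaximizer K₀ i (x' ⊕ YV k)
        extend-by-YV {x'} x'-supp M≤x' with Finite-val⇒InRange K₂ I x' (Finite-≤∞ M-finite M≤x')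
        ... | k , x'≡k = k , x'≡k , maximizer-≤ K₀ i x*-max (⊕-supportedIn x'-supp (YV-supp k))
                                      (subst (M ≤∞_) (val-update I k x'-supp (YV-supp k) x'≡k) M≤x')

        YV'-premise : ∀ x' → IsMaximizer K₂ i x' → SuppIn x' (SAt K₂ (zOf I x'))
        YV'-premise x' (x'-supp , x'-max) w x'w≢0 =
          via (extend-by-YV x'-supp (≤∞-trans M≤xV' (x'-max xV' restrict-supportedIn)))
          where
          w∈V' : w ∈ V'
          w∈V' = supportedIn⇒suppIn x'-supp w x'w≢0

          w∉V : w ∉ V
          w∉V w∈V = V∩V'≡∅ (w , x∈p∩q⁺ (w∈V , w∈V'))

          via : ∃[ k ] zOf I x' ≡ + toℕ k × IsMaximizer K₀ i (x' ⊕ YV k) → w ∈ SAt K₂ (zOf I x')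
          via (k , x'≡k , x'⊕YVk-max) =
            subst (λ z → w ∈ SAt K₂ z) (sym x'≡k)
              (subst (w ∈_) (sym (SAt-toℕ K₂ k)) (x∈p∩q⁺ (x∈p─q⁺ w∈S w∉V , w∈V')))
            where
            w∈S : w ∈ SAt K (zSol YV k)
            w∈S = subst (λ z → w ∈ SAt K z)
                    (trans (zOf-⊕ I x' (YV k)) (cong (λ z → zOf z (YV k)) x'≡k))
                    (maximizer⇒∈S x'⊕YVk-max (x'w≢0 ∘ ℕ.m+n≡0⇒m≡0 (x' w)))

        M≤composition : M ≤∞ val K₀ I ((YV' ∘Y YV) i)
        M≤composition = via (extend-by-YV (proj₁ YV'-correct i)
                                          (≤∞-trans M≤xV' (YV'i-max xV' restrict-supportedIn)))
          where
          YV'i-max : ∀ x' → SupportedIn V' x' → val K₂ I x' ≤∞ val K₂ I (YV' i)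
          YV'i-max = proj₂ (proj₂ YV'-correct i YV'-premise)

          via : ∃[ k ] zOf I (YV' i) ≡ + toℕ k × IsMaximizer K₀ i (YV' i ⊕ YV k) →
                M ≤∞ val K₀ I ((YV' ∘Y YV) i)
          via (k , YV'i≡k , YV'i⊕YVk-max) =
            subst (λ v → M ≤∞ val K₀ I (YV' i ⊕ v))
              (sym (trans (cong (xAt YV) YV'i≡k) (xAt-toℕ YV k)))
              (proj₂ YV'i⊕YVk-max x* (proj₁ x*-max))

      -- When the optimum M is -∞, every supported vector is a maximizer.
      composition-max : IsMaximizer K₀ i ((YV' ∘Y YV) i)
      composition-max =
        maximizer-≤ K₀ i x*-max (composition-isSolution i) (≤∞-from-finite M≤composition)

    composition-correct : CorrectlySolves K₀ (YV' ∘Y YV)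
    composition-correct = composition-isSolution , AtIndex.composition-max

lemma5p13 : ∀ {wmax L : _} (K : Defs.Instance wmax L) → IsKnapsackInstance K →
    (V V' : Subset wmax) → V ⊆ U K → V' ⊆ U K → Empty (V ∩ V') →
    (YV YV' : Sol wmax L) →
    CorrectlySolves (K ∣ V) YV →
    CorrectlySolves (update K V YV ∣ V') YV' →
    CorrectlySolves (K ∣ (V ∪ V')) (YV' ∘Y YV)
lemma5p13 K _ V V' _ _ V∩V'≡∅ YV YV' = Composition.composition-correct K V V' V∩V'≡∅ YV YV'
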